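{- Let $k\ge1$ be an integer and $\alpha$ an indeterminate. For every $n\ge0$, \[n!\sum_F\prod_{v\in V(F)}\left(1+\frac{\alpha}{h(v)}\right)=P_n\bigl(k,(k+1)(1+\alpha),1+\alpha\bigr),\] where the sum is over all unlabeled $k$-colored ordered forests $F$ on $n$ vertices, and for $n\ge1$, \[n!\sum_T\prod_{v\in V(T)}\left(1+\frac{\alpha}{h(v)}\right)=-P_n\bigl(k,(k+1)(1+\alpha),-(1+\alpha)\bigr),\] where the sum is over all unlabeled $k$-colored ordered trees $T$ on $n$ vertices.
   Context: An ordered tree is a rooted tree in which the children of each vertex are linearly ordered; an ordered forest is a forest of ordered trees in which the trees are also linearly ordered. A $k$-colored ordered forest is an ordered forest whose edges are colored with colors $1,\dots,k$ such that among the children of any vertex, those joined by an edge of color $1$ come first, then those of color $2$, and so on (not every color need appear); a $k$-colored ordered tree is one with a single tree. The hook length $h(v)$ is the number of descendants of $v$, including $v$. $P_n(a,b,c)=c\prod_{i=1}^{n-1}(ia+(n-i)b+c)$ for $n\ge1$, and $P_0=1$. -}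

module Defs where

open import Data.Nat as ℕ using (ℕ; zero; suc; _∸_)
open import Data.Integer using (+_)
open import Data.Rational using (ℚ; _/_; _+_; _*_; 0ℚ; 1ℚ)
open import Data.List using (List; []; _∷_; map; foldr; upTo)
open import Data.Vec using (Vec; []; _∷_)
open import Data.Product using (_×_)
open import Data.List.Membership.Propositional using (_∈_)
open import Data.List.Relation.Unary.Unique.Propositional using (Unique)

ℕ→ℚ : ℕ → ℚ
ℕ→ℚ n = + n / 1

sumℚ : List ℚ → ℚ
sumℚ = foldr _+_ 0ℚ

prodℚ : List ℚ → ℚ
prodℚ = foldr _*_ 1ℚ

-- A vertex's ordered sequence of children,
-- whose edge colours are weakly increasing (colour 1 first, then 2, ...),
-- is encoded (bijectively) as a k-tuple of ordered lists: the i-th list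
-- holds, in order, the children joined by an edge of colour i.
data Tree (k : ℕ) : Set where
  node : Vec (List (Tree k)) k → Tree k

Forest : ℕ → Set
Forest k = List (Tree k)

mutual
  -- number of vertices (= hook length of the root)
  size : ∀ {k} → Tree k → ℕ
  size (node cs) = suc (sizeV cs)

  sizeV : ∀ {k m} → Vec (List (Tree k)) m → ℕ
  sizeV [] = 0
  sizeV (l ∷ v) = sizeF l ℕ.+ sizeV v

  sizeF : ∀ {k} → List (Tree k) → ℕ
  sizeF [] = 0
  sizeF (t ∷ ts) = size t ℕ.+ sizeF ts

mutual
  hookW : ∀ {k} → ℚ → Tree k → ℚ
  hookW α (node cs) = (1ℚ + α * (+ 1 / suc (sizeV cs))) * hookWV α cs

  hookWV : ∀ {k m} → ℚ → Vec (List (Tree k)) m → ℚ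
  hookWV α [] = 1ℚ
  hookWV α (l ∷ v) = hookWF α l * hookWV α v

  hookWF : ∀ {k} → ℚ → List (Tree k) → ℚ
  hookWF α [] = 1ℚ
  hookWF α (t ∷ ts) = hookW α t * hookWF α ts

P : ℕ → ℚ → ℚ → ℚ → ℚ
P zero a b c = 1ℚ
P (suc m) a b c =
  c * prodℚ (map (λ j → ℕ→ℚ (suc j) * a + ℕ→ℚ (m ∸ j) * b + c) (upTo m))

IsEnumeration : {A : Set} → (A → Set) → List A → Set
IsEnumeration Q L = Unique L × (∀ x → x ∈ L → Q x) × (∀ x → Q x → x ∈ L)

-- Let f_n, t_n and v_{j,n} be n! times the weighted sums over the forests, the trees, and the
-- j-tuples of forests with n vertices.  Splitting off the first tree of a forest, the first
-- forest of a tuple, and the root of a tree (whose factor 1 + α/n turns n! into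
-- (n - 1)! (n + α)) gives
--   f_{m+1} = Σ C(m+1, s+1) t_{s+1} f_l,   v_{j+1,m} = Σ C(m, i) f_i v_{j,l},
--   t_{m+1} = (m + 1 + α) v_{k,m}.
-- With c = 1 + α, a = k, b = (k + 1) c, the polynomials p_n(x) = P_n(a, b, x) are of binomial
-- type, Σ C(n, i) p_i(x) p_{n-i}(y) = p_n(x + y); this is proved together with the companion
-- identity for r_n(y) = ∏_{j<n} (y + j a + (n - j) b), where p_{n+1}(x) = x r_n(x + a).
-- Hence v_{j,m} = p_m(j c), then t_{m+1} = - p_{m+1}(- c) by an identity of products, and
-- finally binomial type at (- c, c), where p_{m+1}(0) = 0, solves the forest recurrence.
-- Sums over an arbitrary enumeration equal those over a canonical one, because two
-- duplicate-free lists with the same members are permutations of each other.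

module Submission where

open import Defs
open import Level using (0ℓ)
open import Function using (_∘_)
open import Function.Bundles using (mk⇔)
open import Algebra.Bundles using (CommutativeMonoid)
open import Data.Nat as ℕ using (ℕ; zero; suc; _≤_; _!; _∸_; s≤s)
import Data.Nat.Properties as ℕₚ
import Data.Nat.Tactic.RingSolver as ℕ-Solver
open import Data.Nat.Coprimality as Coprime using (1-coprimeTo)
import Data.Integer as ℤ
import Data.Integer.Properties as ℤₚ
open import Data.Rational using (ℚ; _+_; _*_; -_; 0ℚ; 1ℚ; _/_; mkℚ)
open import Data.Rational.Properties as ℚₚ using (+-*-commutativeRing; +-0-commutativeMonoid; _≟_)
open import Data.List using (List; []; _∷_; map; _++_; upTo; cartesianProductWith)
open import Data.List.Properties as Listₚ using (map-++; map-∘; map-cong; map-cong-local; map-applyUpTo)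
open import Data.Vec using (Vec; []; _∷_)
import Data.Vec.Properties as Vecₚ
open import Data.Product using (_×_; _,_; ∃₂)
open import Data.Sum using (inj₁; inj₂)
open import Data.List.Membership.Propositional using (_∈_)
open import Data.List.Membership.Propositional.Properties
  using (∈-map⁺; ∈-map⁻; ∈-++⁺ˡ; ∈-++⁺ʳ; ∈-++⁻; ∈-cartesianProductWith⁺; ∈-cartesianProductWith⁻)
open import Data.List.Membership.Propositional.Properties.WithK using (unique∧set⇒bag)
open import Data.List.Relation.Unary.Any using (here)
import Data.List.Relation.Unary.All as All
open import Data.List.Relation.Unary.Unique.Propositional using (Unique; []; _∷_)
import Data.List.Relation.Unary.Unique.Propositional.Properties as Unique
open import Data.List.Relation.Binary.Disjoint.Propositional using (Disjoint)
open import Data.List.Relation.Binary.BagAndSetEquality using (∼bag⇒↭)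
open import Data.List.Relation.Binary.Permutation.Propositional using (_↭_; ↭⇒↭ₛ)
import Data.List.Relation.Binary.Permutation.Propositional.Properties as ↭
open import Data.List.Relation.Binary.Permutation.Setoid.Properties using (foldr-commMonoid)
open import Relation.Nullary.Decidable using (dec⇒maybe)
open import Relation.Binary.PropositionalEquality
  using (_≡_; refl; sym; trans; cong; cong₂; module ≡-Reasoning)
open import Tactic.RingSolver.Core.AlmostCommutativeRing
  using (AlmostCommutativeRing; fromCommutativeRing)
open import Tactic.RingSolver using (solve-∀)

open ≡-Reasoning

ℚ-ring : AlmostCommutativeRing 0ℓ 0ℓ
ℚ-ring = fromCommutativeRing +-*-commutativeRing (λ x → dec⇒maybe (0ℚ ≟ x))

ℕ→ℚ≡mkℚ : ∀ n → ℕ→ℚ n ≡ mkℚ (ℤ.+ n) 0 (Coprime.sym (1-coprimeTo n))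
ℕ→ℚ≡mkℚ n = ℚₚ.normalize-coprime (Coprime.sym (1-coprimeTo n))

ℕ→ℚ-suc : ∀ n → ℕ→ℚ (suc n) ≡ 1ℚ + ℕ→ℚ n
ℕ→ℚ-suc n rewrite ℕ→ℚ≡mkℚ n = cong (λ i → (ℤ.+ 1 ℤ.+ i) / 1) (sym (ℤₚ.*-identityʳ (ℤ.+ n)))

ℕ→ℚ-+ : ∀ m n → ℕ→ℚ (m ℕ.+ n) ≡ ℕ→ℚ m + ℕ→ℚ n
ℕ→ℚ-+ zero n = sym (ℚₚ.+-identityˡ (ℕ→ℚ n))
ℕ→ℚ-+ (suc m) n = begin
  ℕ→ℚ (suc (m ℕ.+ n))         ≡⟨ ℕ→ℚ-suc (m ℕ.+ n) ⟩
  1ℚ + ℕ→ℚ (m ℕ.+ n)          ≡⟨ cong (1ℚ +_) (ℕ→ℚ-+ m n) ⟩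
  1ℚ + (ℕ→ℚ m + ℕ→ℚ n)        ≡⟨ ℚₚ.+-assoc 1ℚ (ℕ→ℚ m) (ℕ→ℚ n) ⟨
  (1ℚ + ℕ→ℚ m) + ℕ→ℚ n        ≡⟨ cong (_+ ℕ→ℚ n) (ℕ→ℚ-suc m) ⟨
  ℕ→ℚ (suc m) + ℕ→ℚ n         ∎

ℕ→ℚ-* : ∀ m n → ℕ→ℚ (m ℕ.* n) ≡ ℕ→ℚ m * ℕ→ℚ n
ℕ→ℚ-* zero n = sym (ℚₚ.*-zeroˡ (ℕ→ℚ n))
ℕ→ℚ-* (suc m) n = begin
  ℕ→ℚ (n ℕ.+ m ℕ.* n)          ≡⟨ ℕ→ℚ-+ n (m ℕ.* n) ⟩
  ℕ→ℚ n + ℕ→ℚ (m ℕ.* n)        ≡⟨ cong (ℕ→ℚ n +_) (ℕ→ℚ-* m n) ⟩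
  ℕ→ℚ n + ℕ→ℚ m * ℕ→ℚ n        ≡⟨ distrib (ℕ→ℚ m) (ℕ→ℚ n) ⟩
  (1ℚ + ℕ→ℚ m) * ℕ→ℚ n         ≡⟨ cong (_* ℕ→ℚ n) (ℕ→ℚ-suc m) ⟨
  ℕ→ℚ (suc m) * ℕ→ℚ n          ∎
  where
  distrib : ∀ x y → y + x * y ≡ (1ℚ + x) * y
  distrib = solve-∀ ℚ-ring

ℕ→ℚ-*-inverse : ∀ n → ℕ→ℚ (suc n) * (ℤ.+ 1 / suc n) ≡ 1ℚ
ℕ→ℚ-*-inverse n
  rewrite ℕ→ℚ≡mkℚ (suc n) | ℚₚ.normalize-coprime {1} {n} (1-coprimeTo (suc n))
  = ℚₚ.*-inverseʳ (mkℚ (ℤ.+ suc n) 0 (Coprime.sym (1-coprimeTo (suc n))))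

foldAntidiagonal : {A : Set} → (A → A → A) → ℕ → (ℕ → ℕ → A) → A
foldAntidiagonal _∙_ zero    F = F 0 0
foldAntidiagonal _∙_ (suc n) F = F 0 (suc n) ∙ foldAntidiagonal _∙_ n (λ i j → F (suc i) j)

foldAntidiagonal-homo : {A B : Set} {_∙_ : A → A → A} {_∘′_ : B → B → B} (h : A → B) →
  (∀ x y → h (x ∙ y) ≡ h x ∘′ h y) →
  ∀ n F → h (foldAntidiagonal _∙_ n F) ≡ foldAntidiagonal _∘′_ n (λ i j → h (F i j))
foldAntidiagonal-homo h homo zero    F = refl
foldAntidiagonal-homo {_∘′_ = _∘′_} h homo (suc n) F =
  trans (homo _ _) (cong (h (F 0 (suc n)) ∘′_) (foldAntidiagonal-homo h homo n (λ i j → F (suc i) j)))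

Σ-antidiagonal : ℕ → (ℕ → ℕ → ℚ) → ℚ
Σ-antidiagonal = foldAntidiagonal _+_

infix 9 Σ-antidiagonal
syntax Σ-antidiagonal n (λ i j → e) = Σ[ i + j ≐ n ] e

Σ-cong : ∀ n {F G : ℕ → ℕ → ℚ} → (∀ i j → i ℕ.+ j ≡ n → F i j ≡ G i j) →
         Σ-antidiagonal n F ≡ Σ-antidiagonal n G
Σ-cong zero    F≡G = F≡G 0 0 refl
Σ-cong (suc n) F≡G = cong₂ _+_ (F≡G 0 (suc n) refl) (Σ-cong n (λ i j → F≡G (suc i) j ∘ cong suc))

Σ-+ : ∀ n (F G : ℕ → ℕ → ℚ) →
      Σ[ i + j ≐ n ] (F i j + G i j) ≡ Σ-antidiagonal n F + Σ-antidiagonal n G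
Σ-+ zero    F G = refl
Σ-+ (suc n) F G = begin
  (F 0 (suc n) + G 0 (suc n)) + Σ[ i + j ≐ n ] (F (suc i) j + G (suc i) j)
    ≡⟨ cong (F 0 (suc n) + G 0 (suc n) +_) (Σ-+ n (λ i j → F (suc i) j) (λ i j → G (suc i) j)) ⟩
  (F 0 (suc n) + G 0 (suc n)) + (Σ[ i + j ≐ n ] F (suc i) j + Σ[ i + j ≐ n ] G (suc i) j)
    ≡⟨ interchange (F 0 (suc n)) (G 0 (suc n)) _ _ ⟩
  (F 0 (suc n) + Σ[ i + j ≐ n ] F (suc i) j) + (G 0 (suc n) + Σ[ i + j ≐ n ] G (suc i) j) ∎
  where
  interchange : ∀ u v w z → (u + v) + (w + z) ≡ (u + w) + (v + z)
  interchange = solve-∀ ℚ-ring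

Σ-*ˡ : ∀ n u (F : ℕ → ℕ → ℚ) → Σ[ i + j ≐ n ] (u * F i j) ≡ u * Σ-antidiagonal n F
Σ-*ˡ zero    u F = refl
Σ-*ˡ (suc n) u F = begin
  u * F 0 (suc n) + Σ[ i + j ≐ n ] (u * F (suc i) j)
    ≡⟨ cong (u * F 0 (suc n) +_) (Σ-*ˡ n u (λ i j → F (suc i) j)) ⟩
  u * F 0 (suc n) + u * Σ[ i + j ≐ n ] F (suc i) j
    ≡⟨ ℚₚ.*-distribˡ-+ u _ _ ⟨
  u * (F 0 (suc n) + Σ[ i + j ≐ n ] F (suc i) j) ∎

Σ-last : ∀ n (F : ℕ → ℕ → ℚ) →
         Σ-antidiagonal (suc n) F ≡ Σ[ i + j ≐ n ] F i (suc j) + F (suc n) 0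
Σ-last zero    F = refl
Σ-last (suc n) F = begin
  F 0 (suc (suc n)) + Σ-antidiagonal (suc n) (λ i j → F (suc i) j)
    ≡⟨ cong (F 0 (suc (suc n)) +_) (Σ-last n (λ i j → F (suc i) j)) ⟩
  F 0 (suc (suc n)) + (Σ[ i + j ≐ n ] F (suc i) (suc j) + F (suc (suc n)) 0)
    ≡⟨ ℚₚ.+-assoc (F 0 (suc (suc n))) _ _ ⟨
  F 0 (suc (suc n)) + Σ[ i + j ≐ n ] F (suc i) (suc j) + F (suc (suc n)) 0 ∎

Σ-swap : ∀ n (F : ℕ → ℕ → ℚ) → Σ-antidiagonal n F ≡ Σ[ i + j ≐ n ] F j i
Σ-swap zero    F = refl
Σ-swap (suc n) F = begin
  F 0 (suc n) + Σ[ i + j ≐ n ] F (suc i) j   ≡⟨ cong (F 0 (suc n) +_) (Σ-swap n (λ i j → F (suc i) j)) ⟩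
  F 0 (suc n) + Σ[ i + j ≐ n ] F (suc j) i   ≡⟨ ℚₚ.+-comm (F 0 (suc n)) _ ⟩
  Σ[ i + j ≐ n ] F (suc j) i + F 0 (suc n)   ≡⟨ Σ-last n (λ i j → F j i) ⟨
  Σ[ i + j ≐ suc n ] F j i                   ∎

binom : ℕ → ℕ → ℕ
binom zero    j       = 1
binom (suc i) zero    = 1
binom (suc i) (suc j) = binom i (suc j) ℕ.+ binom (suc i) j

binom-comm : ∀ i j → binom i j ≡ binom j i
binom-comm zero    zero    = refl
binom-comm zero    (suc j) = refl
binom-comm (suc i) zero    = refl
binom-comm (suc i) (suc j) = begin
  binom i (suc j) ℕ.+ binom (suc i) j  ≡⟨ cong₂ ℕ._+_ (binom-comm i (suc j)) (binom-comm (suc i) j) ⟩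
  binom (suc j) i ℕ.+ binom j (suc i)  ≡⟨ ℕₚ.+-comm (binom (suc j) i) _ ⟩
  binom j (suc i) ℕ.+ binom (suc j) i  ∎

binom-*-factorials : ∀ i j → binom i j ℕ.* (i ! ℕ.* j !) ≡ (i ℕ.+ j) !
binom-*-factorials zero    j       = trans (ℕₚ.*-identityˡ _) (ℕₚ.*-identityˡ _)
binom-*-factorials (suc i) zero    =
  trans (ℕₚ.*-identityˡ _) (trans (ℕₚ.*-identityʳ _) (cong _! (sym (ℕₚ.+-identityʳ (suc i)))))
binom-*-factorials (suc i) (suc j) = begin
  (binom i (suc j) ℕ.+ binom (suc i) j) ℕ.* (suc i ! ℕ.* suc j !)
    ≡⟨ split (binom i (suc j)) (binom (suc i) j) i j (i !) (j !) ⟩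
  suc i ℕ.* (binom i (suc j) ℕ.* (i ! ℕ.* suc j !)) ℕ.+ suc j ℕ.* (binom (suc i) j ℕ.* (suc i ! ℕ.* j !))
    ≡⟨ cong₂ (λ u v → suc i ℕ.* u ℕ.+ suc j ℕ.* v) (binom-*-factorials i (suc j)) (binom-*-factorials (suc i) j) ⟩
  suc i ℕ.* (i ℕ.+ suc j) ! ℕ.+ suc j ℕ.* suc (i ℕ.+ j) !
    ≡⟨ cong (λ u → suc i ℕ.* u ! ℕ.+ suc j ℕ.* suc (i ℕ.+ j) !) (ℕₚ.+-suc i j) ⟩
  suc i ℕ.* suc (i ℕ.+ j) ! ℕ.+ suc j ℕ.* suc (i ℕ.+ j) !
    ≡⟨ ℕₚ.*-distribʳ-+ (suc (i ℕ.+ j) !) (suc i) (suc j) ⟨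
  (suc i ℕ.+ suc j) ℕ.* suc (i ℕ.+ j) !
    ≡⟨ cong (λ u → suc u ℕ.* suc (i ℕ.+ j) !) (ℕₚ.+-suc i j) ⟩
  suc (suc (i ℕ.+ j)) ℕ.* suc (i ℕ.+ j) !
    ≡⟨ cong (λ u → suc u ℕ.* u !) (ℕₚ.+-suc i j) ⟨
  (suc i ℕ.+ suc j) ! ∎
  where
  split : ∀ B B′ i j I J →
    (B ℕ.+ B′) ℕ.* ((suc i ℕ.* I) ℕ.* (suc j ℕ.* J))
      ≡ suc i ℕ.* (B ℕ.* (I ℕ.* (suc j ℕ.* J))) ℕ.+ suc j ℕ.* (B′ ℕ.* ((suc i ℕ.* I) ℕ.* J))
  split = ℕ-Solver.solve-∀

binom-suc-* : ∀ i j → suc j ℕ.* binom i (suc j) ≡ suc (i ℕ.+ j) ℕ.* binom i j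
binom-suc-* i j = ℕₚ.*-cancelʳ-≡ _ _ (i ! ℕ.* j !) {{ℕₚ._!*_!≢0 i j}} (begin
  suc j ℕ.* binom i (suc j) ℕ.* (i ! ℕ.* j !)        ≡⟨ rearrange (binom i (suc j)) (i !) (j !) j ⟩
  binom i (suc j) ℕ.* (i ! ℕ.* suc j !)              ≡⟨ binom-*-factorials i (suc j) ⟩
  (i ℕ.+ suc j) !                                    ≡⟨ cong _! (ℕₚ.+-suc i j) ⟩
  suc (i ℕ.+ j) ℕ.* (i ℕ.+ j) !                      ≡⟨ cong (suc (i ℕ.+ j) ℕ.*_) (binom-*-factorials i j) ⟨
  suc (i ℕ.+ j) ℕ.* (binom i j ℕ.* (i ! ℕ.* j !))    ≡⟨ ℕₚ.*-assoc (suc (i ℕ.+ j)) (binom i j) (i ! ℕ.* j !) ⟨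
  suc (i ℕ.+ j) ℕ.* binom i j ℕ.* (i ! ℕ.* j !)      ∎)
  where
  rearrange : ∀ B I J j → suc j ℕ.* B ℕ.* (I ℕ.* J) ≡ B ℕ.* (I ℕ.* (suc j ℕ.* J))
  rearrange = ℕ-Solver.solve-∀

binomℚ : ℕ → ℕ → ℚ
binomℚ i j = ℕ→ℚ (binom i j)

binomℚ-suc-* : ∀ i j {m} → i ℕ.+ j ≡ m → ℕ→ℚ (suc j) * binomℚ i (suc j) ≡ ℕ→ℚ (suc m) * binomℚ i j
binomℚ-suc-* i j refl = begin
  ℕ→ℚ (suc j) * binomℚ i (suc j)           ≡⟨ ℕ→ℚ-* (suc j) (binom i (suc j)) ⟨
  ℕ→ℚ (suc j ℕ.* binom i (suc j))          ≡⟨ cong ℕ→ℚ (binom-suc-* i j) ⟩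
  ℕ→ℚ (suc (i ℕ.+ j) ℕ.* binom i j)        ≡⟨ ℕ→ℚ-* (suc (i ℕ.+ j)) (binom i j) ⟩
  ℕ→ℚ (suc (i ℕ.+ j)) * binomℚ i j         ∎

prodℚ-upTo-suc : ∀ m (f : ℕ → ℚ) → prodℚ (map f (upTo (suc m))) ≡ f 0 * prodℚ (map (f ∘ suc) (upTo m))
prodℚ-upTo-suc m f =
  cong (λ xs → f 0 * prodℚ xs) (trans (map-applyUpTo suc f m) (sym (map-applyUpTo (λ j → j) (f ∘ suc) m)))

module BinomialType (a b : ℚ) where

  r : ℕ → ℚ → ℚ
  r zero    y = 1ℚ
  r (suc m) y = (y + ℕ→ℚ (suc m) * b) * r m (y + a)

  p : ℕ → ℚ → ℚ
  p zero    x = 1ℚ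
  p (suc m) x = x * r m (x + a)

  r-suc-split : ∀ m y → r (suc m) y ≡ p (suc m) y + ℕ→ℚ (suc m) * b * r m (y + a)
  r-suc-split m y = ℚₚ.*-distribʳ-+ (r m (y + a)) y (ℕ→ℚ (suc m) * b)

  shiftedSum : ℕ → ℚ → ℚ → ℚ
  shiftedSum m x y = Σ[ i + j ≐ m ] (binomℚ (suc i) j * r i (x + a) * r j (y + a))

  Σpr-peel : ∀ m x y → Σ[ i + j ≐ suc m ] (binomℚ i j * p i x * r j (y + a))
                         ≡ r (suc m) (y + a) + x * shiftedSum m x y
  Σpr-peel m x y = cong₂ _+_ (ℚₚ.*-identityˡ (r (suc m) (y + a)))
    (trans (Σ-cong m (λ i j _ → pull-out (binomℚ (suc i) j) x _ _))
           (Σ-*ˡ m x (λ i j → binomℚ (suc i) j * r i (x + a) * r j (y + a))))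
    where
    pull-out : ∀ B x R S → B * (x * R) * S ≡ x * (B * R * S)
    pull-out = solve-∀ ℚ-ring

  Σpp-pascal : ∀ m x y → Σ[ i + j ≐ m ] (binomℚ (suc i) (suc j) * p (suc i) x * p (suc j) y)
                           ≡ x * y * (shiftedSum m y x + shiftedSum m x y)
  Σpp-pascal m x y = begin
    Σ[ i + j ≐ m ] (binomℚ (suc i) (suc j) * p (suc i) x * p (suc j) y)
      ≡⟨ Σ-cong m (λ i j _ → trans (cong (λ B → B * p (suc i) x * p (suc j) y) (ℕ→ℚ-+ (binom i (suc j)) _))
                                    (split (binomℚ i (suc j)) (binomℚ (suc i) j) x y _ _)) ⟩
    Σ[ i + j ≐ m ] (x * y * (binomℚ i (suc j) * r i (x + a) * r j (y + a))
                    + x * y * (binomℚ (suc i) j * r i (x + a) * r j (y + a)))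
      ≡⟨ Σ-+ m _ _ ⟩
    Σ[ i + j ≐ m ] (x * y * (binomℚ i (suc j) * r i (x + a) * r j (y + a)))
      + Σ[ i + j ≐ m ] (x * y * (binomℚ (suc i) j * r i (x + a) * r j (y + a)))
      ≡⟨ cong₂ _+_ (Σ-*ˡ m (x * y) _) (Σ-*ˡ m (x * y) _) ⟩
    x * y * Σ[ i + j ≐ m ] (binomℚ i (suc j) * r i (x + a) * r j (y + a)) + x * y * shiftedSum m x y
      ≡⟨ cong (λ u → x * y * u + x * y * shiftedSum m x y) swapped ⟩
    x * y * shiftedSum m y x + x * y * shiftedSum m x y
      ≡⟨ ℚₚ.*-distribˡ-+ (x * y) _ _ ⟨
    x * y * (shiftedSum m y x + shiftedSum m x y) ∎
    where
    split : ∀ B B′ x y R S → (B + B′) * (x * R) * (y * S) ≡ x * y * (B * R * S) + x * y * (B′ * R * S)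
    split = solve-∀ ℚ-ring
    swap-factors : ∀ B R S → B * S * R ≡ B * R * S
    swap-factors = solve-∀ ℚ-ring
    swapped : Σ[ i + j ≐ m ] (binomℚ i (suc j) * r i (x + a) * r j (y + a)) ≡ shiftedSum m y x
    swapped = trans (Σ-swap m _) (Σ-cong m λ i j _ →
      trans (cong (λ B → B * r j (x + a) * r i (y + a)) (cong ℕ→ℚ (binom-comm j (suc i))))
            (swap-factors (binomℚ (suc i) j) (r i (y + a)) (r j (x + a))))

  Σpp-split : ∀ m x y →
    Σ[ i + j ≐ suc (suc m) ] (binomℚ i j * p i x * p j y)
      ≡ p (suc (suc m)) y + x * y * (shiftedSum m y x + shiftedSum m x y) + p (suc (suc m)) x
  Σpp-split m x y = begin
    1ℚ * 1ℚ * p (suc (suc m)) y + Σ[ i + j ≐ suc m ] (binomℚ (suc i) j * p (suc i) x * p j y)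
      ≡⟨ cong₂ _+_ (ℚₚ.*-identityˡ (p (suc (suc m)) y))
                    (Σ-last m (λ i j → binomℚ (suc i) j * p (suc i) x * p j y)) ⟩
    p (suc (suc m)) y + (Σ[ i + j ≐ m ] (binomℚ (suc i) (suc j) * p (suc i) x * p (suc j) y)
                          + 1ℚ * p (suc (suc m)) x * 1ℚ)
      ≡⟨ cong₂ (λ u v → p (suc (suc m)) y + (u + v)) (Σpp-pascal m x y)
               (trans (ℚₚ.*-identityʳ _) (ℚₚ.*-identityˡ (p (suc (suc m)) x))) ⟩
    p (suc (suc m)) y + (x * y * (shiftedSum m y x + shiftedSum m x y) + p (suc (suc m)) x)
      ≡⟨ ℚₚ.+-assoc (p (suc (suc m)) y) _ _ ⟨
    p (suc (suc m)) y + x * y * (shiftedSum m y x + shiftedSum m x y) + p (suc (suc m)) x ∎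

  pr-term-split : ∀ i j {m} x y → i ℕ.+ j ≡ m →
    binomℚ i (suc j) * p i x * r (suc j) y
      ≡ binomℚ i (suc j) * p i x * p (suc j) y + ℕ→ℚ (suc m) * b * (binomℚ i j * p i x * r j (y + a))
  pr-term-split i j {m} x y i+j≡m = begin
    binomℚ i (suc j) * p i x * r (suc j) y
      ≡⟨ cong (binomℚ i (suc j) * p i x *_) (r-suc-split j y) ⟩
    binomℚ i (suc j) * p i x * (p (suc j) y + ℕ→ℚ (suc j) * b * r j (y + a))
      ≡⟨ expand (binomℚ i (suc j)) (p i x) (p (suc j) y) (ℕ→ℚ (suc j)) b (r j (y + a)) ⟩
    binomℚ i (suc j) * p i x * p (suc j) y + b * (ℕ→ℚ (suc j) * binomℚ i (suc j)) * p i x * r j (y + a)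
      ≡⟨ cong (λ u → binomℚ i (suc j) * p i x * p (suc j) y + b * u * p i x * r j (y + a))
              (binomℚ-suc-* i j i+j≡m) ⟩
    binomℚ i (suc j) * p i x * p (suc j) y + b * (ℕ→ℚ (suc m) * binomℚ i j) * p i x * r j (y + a)
      ≡⟨ regroup (binomℚ i (suc j)) (p i x) (p (suc j) y) (ℕ→ℚ (suc m)) b (r j (y + a)) (binomℚ i j) ⟩
    binomℚ i (suc j) * p i x * p (suc j) y + ℕ→ℚ (suc m) * b * (binomℚ i j * p i x * r j (y + a)) ∎
    where
    expand : ∀ B P Q J b R → B * P * (Q + J * b * R) ≡ B * P * Q + b * (J * B) * P * R
    expand = solve-∀ ℚ-ring
    regroup : ∀ B P Q M b R B′ → B * P * Q + b * (M * B′) * P * R ≡ B * P * Q + M * b * (B′ * P * R)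
    regroup = solve-∀ ℚ-ring

  Σpr-split : ∀ m x y →
    Σ[ i + j ≐ suc m ] (binomℚ i j * p i x * r j y)
      ≡ Σ[ i + j ≐ suc m ] (binomℚ i j * p i x * p j y)
        + ℕ→ℚ (suc m) * b * Σ[ i + j ≐ m ] (binomℚ i j * p i x * r j (y + a))
  Σpr-split m x y = begin
    Σ[ i + j ≐ suc m ] (binomℚ i j * p i x * r j y)
      ≡⟨ Σ-last m (λ i j → binomℚ i j * p i x * r j y) ⟩
    Σ[ i + j ≐ m ] (binomℚ i (suc j) * p i x * r (suc j) y) + final
      ≡⟨ cong (_+ final) (Σ-cong m (λ i j → pr-term-split i j x y)) ⟩
    Σ[ i + j ≐ m ] (binomℚ i (suc j) * p i x * p (suc j) y + M * b * (binomℚ i j * p i x * r j (y + a)))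
      + final
      ≡⟨ cong (_+ final) (trans (Σ-+ m _ _) (cong (S₁ +_) (Σ-*ˡ m (M * b) _))) ⟩
    S₁ + M * b * S₂ + final
      ≡⟨ swap-last S₁ (M * b * S₂) final ⟩
    S₁ + final + M * b * S₂
      ≡⟨ cong (_+ M * b * S₂) (Σ-last m (λ i j → binomℚ i j * p i x * p j y)) ⟨
    Σ[ i + j ≐ suc m ] (binomℚ i j * p i x * p j y) + M * b * S₂ ∎
    where
    M final S₁ S₂ : ℚ
    M = ℕ→ℚ (suc m)
    final = binomℚ (suc m) 0 * p (suc m) x * 1ℚ
    S₁ = Σ[ i + j ≐ m ] (binomℚ i (suc j) * p i x * p (suc j) y)
    S₂ = Σ[ i + j ≐ m ] (binomℚ i j * p i x * r j (y + a))
    swap-last : ∀ u v w → u + v + w ≡ u + w + v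
    swap-last = solve-∀ ℚ-ring

  -- (x + y) r (x + y + a) is split as x r (y + (x + a)) + y r (x + (y + a)), and each part is
  -- expanded by the r-identity with the roles of x and y exchanged.
  p-binomial-step : ∀ m →
    (∀ x y → Σ[ i + j ≐ suc m ] (binomℚ i j * p i x * r j y) ≡ r (suc m) (x + y)) →
    ∀ x y → Σ[ i + j ≐ suc (suc m) ] (binomℚ i j * p i x * p j y) ≡ p (suc (suc m)) (x + y)
  p-binomial-step m r-binomial x y = begin
    Σ[ i + j ≐ suc (suc m) ] (binomℚ i j * p i x * p j y)
      ≡⟨ Σpp-split m x y ⟩
    y * r (suc m) (y + a) + x * y * (shiftedSum m y x + shiftedSum m x y) + x * r (suc m) (x + a)
      ≡⟨ regroup x y (r (suc m) (y + a)) (r (suc m) (x + a)) (shiftedSum m y x) (shiftedSum m x y) ⟩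
    x * (r (suc m) (x + a) + y * shiftedSum m y x) + y * (r (suc m) (y + a) + x * shiftedSum m x y)
      ≡⟨ cong₂ (λ u v → x * u + y * v) (r-binomial-peeled y x) (r-binomial-peeled x y) ⟨
    x * r (suc m) (y + (x + a)) + y * r (suc m) (x + (y + a))
      ≡⟨ cong₂ (λ u v → x * r (suc m) u + y * r (suc m) v) (reassoc y x a) (sym (ℚₚ.+-assoc x y a)) ⟩
    x * r (suc m) (x + y + a) + y * r (suc m) (x + y + a)
      ≡⟨ ℚₚ.*-distribʳ-+ (r (suc m) (x + y + a)) x y ⟨
    (x + y) * r (suc m) (x + y + a) ∎
    where
    regroup : ∀ x y R S U V → y * R + x * y * (U + V) + x * S ≡ x * (S + y * U) + y * (R + x * V)
    regroup = solve-∀ ℚ-ring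
    reassoc : ∀ u v w → u + (v + w) ≡ v + u + w
    reassoc = solve-∀ ℚ-ring
    r-binomial-peeled : ∀ x y → r (suc m) (x + (y + a)) ≡ r (suc m) (y + a) + x * shiftedSum m x y
    r-binomial-peeled x y = trans (sym (r-binomial x (y + a))) (Σpr-peel m x y)

  r-binomial-step : ∀ m →
    (∀ x y → Σ[ i + j ≐ suc m ] (binomℚ i j * p i x * p j y) ≡ p (suc m) (x + y)) →
    (∀ x y → Σ[ i + j ≐ m ] (binomℚ i j * p i x * r j y) ≡ r m (x + y)) →
    ∀ x y → Σ[ i + j ≐ suc m ] (binomℚ i j * p i x * r j y) ≡ r (suc m) (x + y)
  r-binomial-step m p-binomial r-binomial x y = begin
    Σ[ i + j ≐ suc m ] (binomℚ i j * p i x * r j y)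
      ≡⟨ Σpr-split m x y ⟩
    Σ[ i + j ≐ suc m ] (binomℚ i j * p i x * p j y)
      + ℕ→ℚ (suc m) * b * Σ[ i + j ≐ m ] (binomℚ i j * p i x * r j (y + a))
      ≡⟨ cong₂ (λ u v → u + ℕ→ℚ (suc m) * b * v) (p-binomial x y) (r-binomial x (y + a)) ⟩
    p (suc m) (x + y) + ℕ→ℚ (suc m) * b * r m (x + (y + a))
      ≡⟨ cong (λ z → p (suc m) (x + y) + ℕ→ℚ (suc m) * b * r m z) (ℚₚ.+-assoc x y a) ⟨
    p (suc m) (x + y) + ℕ→ℚ (suc m) * b * r m (x + y + a)
      ≡⟨ r-suc-split m (x + y) ⟨
    r (suc m) (x + y) ∎

  mutual
    p-binomial : ∀ n x y → Σ[ i + j ≐ n ] (binomℚ i j * p i x * p j y) ≡ p n (x + y)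
    p-binomial zero          x y = refl
    p-binomial (suc zero)    x y = base x y
      where
      base : ∀ x y → 1ℚ * 1ℚ * (y * 1ℚ) + 1ℚ * (x * 1ℚ) * 1ℚ ≡ (x + y) * 1ℚ
      base = solve-∀ ℚ-ring
    p-binomial (suc (suc m)) = p-binomial-step m (r-binomial (suc m))

    r-binomial : ∀ n x y → Σ[ i + j ≐ n ] (binomℚ i j * p i x * r j y) ≡ r n (x + y)
    r-binomial zero    x y = refl
    r-binomial (suc m) = r-binomial-step m (p-binomial (suc m)) (r-binomial m)

  r-suc-last : ∀ m y → r (suc m) y ≡ (y + ℕ→ℚ m * a + b) * r m (y + b)
  r-suc-last zero    y = shift y a b
    where
    shift : ∀ y a b → (y + 1ℚ * b) * 1ℚ ≡ (y + 0ℚ * a + b) * 1ℚ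
    shift = solve-∀ ℚ-ring
  r-suc-last (suc m) y = begin
    (y + ℕ→ℚ (suc (suc m)) * b) * r (suc m) (y + a)
      ≡⟨ cong ((y + ℕ→ℚ (suc (suc m)) * b) *_) (r-suc-last m (y + a)) ⟩
    (y + ℕ→ℚ (suc (suc m)) * b) * ((y + a + ℕ→ℚ m * a + b) * r m (y + a + b))
      ≡⟨ cong₂ (λ u v → (y + u * b) * ((y + a + ℕ→ℚ m * a + b) * r m v))
               (trans (ℕ→ℚ-suc (suc m)) (cong (1ℚ +_) (ℕ→ℚ-suc m))) (+-right-comm y a b) ⟩
    (y + (1ℚ + (1ℚ + ℕ→ℚ m)) * b) * ((y + a + ℕ→ℚ m * a + b) * r m (y + b + a))
      ≡⟨ exchange y a b (ℕ→ℚ m) (r m (y + b + a)) ⟩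
    (y + (1ℚ + ℕ→ℚ m) * a + b) * ((y + b + (1ℚ + ℕ→ℚ m) * b) * r m (y + b + a))
      ≡⟨ cong (λ u → (y + u * a + b) * ((y + b + u * b) * r m (y + b + a))) (ℕ→ℚ-suc m) ⟨
    (y + ℕ→ℚ (suc m) * a + b) * r (suc m) (y + b) ∎
    where
    +-right-comm : ∀ u v w → u + v + w ≡ u + w + v
    +-right-comm = solve-∀ ℚ-ring
    exchange : ∀ y a b m R →
      (y + (1ℚ + (1ℚ + m)) * b) * ((y + a + m * a + b) * R) ≡ (y + (1ℚ + m) * a + b) * ((y + b + (1ℚ + m) * b) * R)
    exchange = solve-∀ ℚ-ring

  tree-identity : ∀ c → b ≡ (1ℚ + a) * c → ∀ m → (ℕ→ℚ m + c) * p m (a * c) ≡ - p (suc m) (- c)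
  tree-identity c b≡[1+a]c zero    = base c
    where
    base : ∀ c → (0ℚ + c) * 1ℚ ≡ - (- c * 1ℚ)
    base = solve-∀ ℚ-ring
  tree-identity c b≡[1+a]c (suc m) = begin
    (ℕ→ℚ (suc m) + c) * (a * c * r m (a * c + a))
      ≡⟨ cong (λ u → (u + c) * (a * c * r m (a * c + a))) (ℕ→ℚ-suc m) ⟩
    (1ℚ + ℕ→ℚ m + c) * (a * c * r m (a * c + a))
      ≡⟨ expand a c (ℕ→ℚ m) (r m (a * c + a)) ⟩
    - (- c * ((- c + a + ℕ→ℚ m * a + (1ℚ + a) * c) * r m (a * c + a)))
      ≡⟨ cong₂ (λ u v → - (- c * ((- c + a + ℕ→ℚ m * a + u) * r m v))) (sym b≡[1+a]c) shift ⟩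
    - (- c * ((- c + a + ℕ→ℚ m * a + b) * r m (- c + a + b)))
      ≡⟨ cong (λ z → - (- c * z)) (r-suc-last m (- c + a)) ⟨
    - (- c * r (suc m) (- c + a)) ∎
    where
    expand : ∀ a c m R → (1ℚ + m + c) * (a * c * R) ≡ - (- c * ((- c + a + m * a + (1ℚ + a) * c) * R))
    expand = solve-∀ ℚ-ring
    shift′ : ∀ a c → a * c + a ≡ - c + a + (1ℚ + a) * c
    shift′ = solve-∀ ℚ-ring
    shift : a * c + a ≡ - c + a + b
    shift = trans (shift′ a c) (cong (- c + a +_) (sym b≡[1+a]c))

  -- Binomial type at (- x, x): the whole sum is p (suc m) 0 = 0, and its i = 0 term is p (suc m) x.
  forest-identity : ∀ x m → Σ[ s + l ≐ m ] (binomℚ (suc s) l * (- p (suc s) (- x)) * p l x) ≡ p (suc m) x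
  forest-identity x m = begin
    Σ[ s + l ≐ m ] (binomℚ (suc s) l * (- p (suc s) (- x)) * p l x)
      ≡⟨ Σ-cong m (λ s l _ → pull-sign (binomℚ (suc s) l) (p (suc s) (- x)) (p l x)) ⟩
    Σ[ s + l ≐ m ] (- 1ℚ * (binomℚ (suc s) l * p (suc s) (- x) * p l x))
      ≡⟨ Σ-*ˡ m (- 1ℚ) (λ s l → binomℚ (suc s) l * p (suc s) (- x) * p l x) ⟩
    - 1ℚ * S
      ≡⟨ isolate (p (suc m) x) S ⟩
    p (suc m) x + - (1ℚ * 1ℚ * p (suc m) x + S)
      ≡⟨ cong (λ u → p (suc m) x + - u) (p-binomial (suc m) (- x) x) ⟩
    p (suc m) x + - ((- x + x) * r m (- x + x + a))
      ≡⟨ vanish x (p (suc m) x) (r m (- x + x + a)) ⟩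
    p (suc m) x ∎
    where
    S : ℚ
    S = Σ[ s + l ≐ m ] (binomℚ (suc s) l * p (suc s) (- x) * p l x)
    pull-sign : ∀ B P Q → B * (- P) * Q ≡ - 1ℚ * (B * P * Q)
    pull-sign = solve-∀ ℚ-ring
    isolate : ∀ P S → - 1ℚ * S ≡ P + - (1ℚ * 1ℚ * P + S)
    isolate = solve-∀ ℚ-ring
    vanish : ∀ x P R → P + - ((- x + x) * R) ≡ P
    vanish = solve-∀ ℚ-ring

  shift-factor : ∀ j X y → ℕ→ℚ j * a + X * b + (y + a) ≡ ℕ→ℚ (suc j) * a + X * b + y
  shift-factor j X y = trans (move-a (ℕ→ℚ j) a X b y) (cong (λ u → u * a + X * b + y) (sym (ℕ→ℚ-suc j)))
    where
    move-a : ∀ J a X b y → J * a + X * b + (y + a) ≡ (1ℚ + J) * a + X * b + y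
    move-a = solve-∀ ℚ-ring

  r≡prodℚ : ∀ m y → r m y ≡ prodℚ (map (λ j → ℕ→ℚ j * a + ℕ→ℚ (m ∸ j) * b + y) (upTo m))
  r≡prodℚ zero    y = refl
  r≡prodℚ (suc m) y = begin
    (y + ℕ→ℚ (suc m) * b) * r m (y + a)
      ≡⟨ cong₂ _*_ (first-factor y (ℕ→ℚ (suc m)) a b) (r≡prodℚ m (y + a)) ⟩
    (0ℚ * a + ℕ→ℚ (suc m) * b + y) * prodℚ (map (λ j → ℕ→ℚ j * a + ℕ→ℚ (m ∸ j) * b + (y + a)) (upTo m))
      ≡⟨ cong (λ xs → (0ℚ * a + ℕ→ℚ (suc m) * b + y) * prodℚ xs)
              (map-cong (λ j → shift-factor j (ℕ→ℚ (m ∸ j)) y) (upTo m)) ⟩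
    (0ℚ * a + ℕ→ℚ (suc m) * b + y) * prodℚ (map (λ j → ℕ→ℚ (suc j) * a + ℕ→ℚ (m ∸ j) * b + y) (upTo m))
      ≡⟨ prodℚ-upTo-suc m (λ j → ℕ→ℚ j * a + ℕ→ℚ (suc m ∸ j) * b + y) ⟨
    prodℚ (map (λ j → ℕ→ℚ j * a + ℕ→ℚ (suc m ∸ j) * b + y) (upTo (suc m))) ∎
    where
    first-factor : ∀ y M a b → y + M * b ≡ 0ℚ * a + M * b + y
    first-factor = solve-∀ ℚ-ring

  P≡p : ∀ n x → P n a b x ≡ p n x
  P≡p zero    x = refl
  P≡p (suc m) x = cong (x *_) (sym (trans (r≡prodℚ m (x + a))
    (cong prodℚ (map-cong (λ j → shift-factor j (ℕ→ℚ (m ∸ j)) x) (upTo m)))))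

sumℚ-++ : ∀ xs ys → sumℚ (xs ++ ys) ≡ sumℚ xs + sumℚ ys
sumℚ-++ []       ys = sym (ℚₚ.+-identityˡ (sumℚ ys))
sumℚ-++ (x ∷ xs) ys = trans (cong (x +_) (sumℚ-++ xs ys)) (sym (ℚₚ.+-assoc x (sumℚ xs) (sumℚ ys)))

sumℚ-map-*ˡ : {A : Set} (u : ℚ) (f : A → ℚ) (xs : List A) →
              sumℚ (map (λ x → u * f x) xs) ≡ u * sumℚ (map f xs)
sumℚ-map-*ˡ u f []       = sym (ℚₚ.*-zeroʳ u)
sumℚ-map-*ˡ u f (x ∷ xs) =
  trans (cong (u * f x +_) (sumℚ-map-*ˡ u f xs)) (sym (ℚₚ.*-distribˡ-+ u (f x) (sumℚ (map f xs))))

sumℚ-cartesianProductWith : {A B C : Set} (f : A → B → C) (h : C → ℚ) (g₁ : A → ℚ) (g₂ : B → ℚ) →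
  (∀ x y → h (f x y) ≡ g₁ x * g₂ y) →
  ∀ xs ys → sumℚ (map h (cartesianProductWith f xs ys)) ≡ sumℚ (map g₁ xs) * sumℚ (map g₂ ys)
sumℚ-cartesianProductWith f h g₁ g₂ h∘f≡g₁*g₂ []       ys = sym (ℚₚ.*-zeroˡ (sumℚ (map g₂ ys)))
sumℚ-cartesianProductWith f h g₁ g₂ h∘f≡g₁*g₂ (x ∷ xs) ys = begin
  sumℚ (map h (map (f x) ys ++ cartesianProductWith f xs ys))
    ≡⟨ trans (cong sumℚ (map-++ h (map (f x) ys) _)) (sumℚ-++ (map h (map (f x) ys)) _) ⟩
  sumℚ (map h (map (f x) ys)) + sumℚ (map h (cartesianProductWith f xs ys))
    ≡⟨ cong₂ _+_ row (sumℚ-cartesianProductWith f h g₁ g₂ h∘f≡g₁*g₂ xs ys) ⟩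
  g₁ x * sumℚ (map g₂ ys) + sumℚ (map g₁ xs) * sumℚ (map g₂ ys)
    ≡⟨ ℚₚ.*-distribʳ-+ (sumℚ (map g₂ ys)) (g₁ x) _ ⟨
  (g₁ x + sumℚ (map g₁ xs)) * sumℚ (map g₂ ys) ∎
  where
  row : sumℚ (map h (map (f x) ys)) ≡ g₁ x * sumℚ (map g₂ ys)
  row = trans (cong sumℚ (trans (sym (map-∘ ys)) (map-cong (h∘f≡g₁*g₂ x) ys))) (sumℚ-map-*ˡ (g₁ x) g₂ ys)

sumℚ-↭ : {xs ys : List ℚ} → xs ↭ ys → sumℚ xs ≡ sumℚ ys
sumℚ-↭ xs↭ys = foldr-commMonoid setoid isCommutativeMonoid (↭⇒↭ₛ xs↭ys)
  where open CommutativeMonoid +-0-commutativeMonoid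

enumerations-↭ : {A : Set} {Q : A → Set} {L L′ : List A} →
                 IsEnumeration Q L → IsEnumeration Q L′ → L ↭ L′
enumerations-↭ (L-unique , L-sound , L-complete) (L′-unique , L′-sound , L′-complete) =
  ∼bag⇒↭ (unique∧set⇒bag L-unique L′-unique
    (mk⇔ (λ x∈L → L′-complete _ (L-sound _ x∈L)) (λ x∈L′ → L-complete _ (L′-sound _ x∈L′))))

sumℚ-map-enumerations : {A : Set} {Q : A → Set} {L L′ : List A} (f : A → ℚ) →
  IsEnumeration Q L → IsEnumeration Q L′ → sumℚ (map f L) ≡ sumℚ (map f L′)
sumℚ-map-enumerations f L-enum L′-enum = sumℚ-↭ (↭.map⁺ f (enumerations-↭ L-enum L′-enum))

module _ {X : Set} where

  concatAntidiagonal : ℕ → (ℕ → ℕ → List X) → List X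
  concatAntidiagonal = foldAntidiagonal _++_

  ∈-concatAntidiagonal⁺ : ∀ n {G : ℕ → ℕ → List X} {x} i j → i ℕ.+ j ≡ n → x ∈ G i j →
                          x ∈ concatAntidiagonal n G
  ∈-concatAntidiagonal⁺ zero    zero    zero    refl x∈G = x∈G
  ∈-concatAntidiagonal⁺ (suc n) zero    (suc n) refl x∈G = ∈-++⁺ˡ x∈G
  ∈-concatAntidiagonal⁺ (suc n) {G} (suc i) j i+j≡n x∈G =
    ∈-++⁺ʳ (G 0 (suc n)) (∈-concatAntidiagonal⁺ n i j (ℕₚ.suc-injective i+j≡n) x∈G)

  ∈-concatAntidiagonal⁻ : ∀ n {G : ℕ → ℕ → List X} {x} → x ∈ concatAntidiagonal n G →
                          ∃₂ λ i j → i ℕ.+ j ≡ n × x ∈ G i j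
  ∈-concatAntidiagonal⁻ zero    x∈ = 0 , 0 , refl , x∈
  ∈-concatAntidiagonal⁻ (suc n) {G} x∈ with ∈-++⁻ (G 0 (suc n)) x∈
  ... | inj₁ x∈G = 0 , suc n , refl , x∈G
  ... | inj₂ x∈rest with ∈-concatAntidiagonal⁻ n x∈rest
  ...   | i , j , i+j≡n , x∈G = suc i , j , cong suc i+j≡n , x∈G

  concatAntidiagonal-unique : ∀ n {G : ℕ → ℕ → List X} (key : X → ℕ) →
    (∀ i j → Unique (G i j)) → (∀ i j {x} → x ∈ G i j → key x ≡ i) → Unique (concatAntidiagonal n G)
  concatAntidiagonal-unique zero    key G-unique keyed = G-unique 0 0
  concatAntidiagonal-unique (suc n) {G} key G-unique keyed = Unique.++⁺ (G-unique 0 (suc n))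
    (concatAntidiagonal-unique n (ℕ.pred ∘ key) (λ i j → G-unique (suc i) j)
                                 (λ i j x∈G → cong ℕ.pred (keyed (suc i) j x∈G)))
    disjoint
    where
    disjoint : Disjoint (G 0 (suc n)) (concatAntidiagonal n (λ i j → G (suc i) j))
    disjoint (x∈first , x∈rest) with ∈-concatAntidiagonal⁻ n x∈rest
    ... | i , j , _ , x∈G = ℕₚ.0≢1+n (trans (sym (keyed 0 (suc n) x∈first)) (keyed (suc i) j x∈G))

sumℚ-concatAntidiagonal : {X : Set} (f : X → ℚ) (n : ℕ) (G : ℕ → ℕ → List X) →
  sumℚ (map f (concatAntidiagonal n G)) ≡ Σ[ i + j ≐ n ] sumℚ (map f (G i j))
sumℚ-concatAntidiagonal f = foldAntidiagonal-homo (sumℚ ∘ map f)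
  (λ xs ys → trans (cong sumℚ (map-++ f xs ys)) (sumℚ-++ (map f xs) (map f ys)))

factorial-split : ∀ i l {m} → i ℕ.+ l ≡ m → ∀ X Y →
  ℕ→ℚ (m !) * (X * Y) ≡ binomℚ i l * (ℕ→ℚ (i !) * X) * (ℕ→ℚ (l !) * Y)
factorial-split i l refl X Y = begin
  ℕ→ℚ ((i ℕ.+ l) !) * (X * Y)                          ≡⟨ cong (λ u → ℕ→ℚ u * (X * Y)) (binom-*-factorials i l) ⟨
  ℕ→ℚ (binom i l ℕ.* (i ! ℕ.* l !)) * (X * Y)          ≡⟨ cong (_* (X * Y)) cast ⟩
  binomℚ i l * (ℕ→ℚ (i !) * ℕ→ℚ (l !)) * (X * Y)       ≡⟨ regroup (binomℚ i l) (ℕ→ℚ (i !)) (ℕ→ℚ (l !)) X Y ⟩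
  binomℚ i l * (ℕ→ℚ (i !) * X) * (ℕ→ℚ (l !) * Y)       ∎
  where
  cast : ℕ→ℚ (binom i l ℕ.* (i ! ℕ.* l !)) ≡ binomℚ i l * (ℕ→ℚ (i !) * ℕ→ℚ (l !))
  cast = trans (ℕ→ℚ-* (binom i l) _) (cong (binomℚ i l *_) (ℕ→ℚ-* (i !) (l !)))
  regroup : ∀ B I L X Y → B * (I * L) * (X * Y) ≡ B * (I * X) * (L * Y)
  regroup = solve-∀ ℚ-ring

factorial-weighted-sum : ∀ {A B C : Set} (f : A → B → C) (h : C → ℚ) (g₁ : A → ℚ) (g₂ : B → ℚ) →
  (∀ x y → h (f x y) ≡ g₁ x * g₂ y) → ∀ (G₁ : ℕ → List A) (G₂ : ℕ → List B) d m →
  ℕ→ℚ ((d ℕ.+ m) !) * sumℚ (map h (concatAntidiagonal m (λ i l → cartesianProductWith f (G₁ i) (G₂ l))))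
    ≡ Σ[ i + l ≐ m ] (binomℚ (d ℕ.+ i) l * (ℕ→ℚ ((d ℕ.+ i) !) * sumℚ (map g₁ (G₁ i)))
                                        * (ℕ→ℚ (l !) * sumℚ (map g₂ (G₂ l))))
factorial-weighted-sum f h g₁ g₂ h∘f≡g₁*g₂ G₁ G₂ d m = begin
  ℕ→ℚ ((d ℕ.+ m) !) * sumℚ (map h (concatAntidiagonal m (λ i l → cartesianProductWith f (G₁ i) (G₂ l))))
    ≡⟨ cong (ℕ→ℚ ((d ℕ.+ m) !) *_) (trans (sumℚ-concatAntidiagonal h m _)
         (Σ-cong m (λ i l _ → sumℚ-cartesianProductWith f h g₁ g₂ h∘f≡g₁*g₂ (G₁ i) (G₂ l)))) ⟩
  ℕ→ℚ ((d ℕ.+ m) !) * Σ[ i + l ≐ m ] (sumℚ (map g₁ (G₁ i)) * sumℚ (map g₂ (G₂ l)))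
    ≡⟨ Σ-*ˡ m (ℕ→ℚ ((d ℕ.+ m) !)) (λ i l → sumℚ (map g₁ (G₁ i)) * sumℚ (map g₂ (G₂ l))) ⟨
  Σ[ i + l ≐ m ] (ℕ→ℚ ((d ℕ.+ m) !) * (sumℚ (map g₁ (G₁ i)) * sumℚ (map g₂ (G₂ l))))
    ≡⟨ Σ-cong m (λ i l i+l≡m → factorial-split (d ℕ.+ i) l (trans (ℕₚ.+-assoc d i l) (cong (d ℕ.+_) i+l≡m)) _ _) ⟩
  Σ[ i + l ≐ m ] (binomℚ (d ℕ.+ i) l * (ℕ→ℚ ((d ℕ.+ i) !) * sumℚ (map g₁ (G₁ i)))
                                     * (ℕ→ℚ (l !) * sumℚ (map g₂ (G₂ l)))) ∎

summands-≤ : ∀ i j {n N} → i ℕ.+ j ≡ n → n ≤ N → i ≤ N × j ≤ N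
summands-≤ i j refl i+j≤N = ℕₚ.m+n≤o⇒m≤o i i+j≤N , ℕₚ.m+n≤o⇒n≤o i i+j≤N

-- N is fuel: trees N n, forests N n and childVectors N j n list each object of size n exactly
-- once as long as n ≤ suc N, n ≤ N and n ≤ N respectively.
module Enumeration (k : ℕ) where

  mutual
    trees : ℕ → ℕ → List (Tree k)
    trees N zero    = []
    trees N (suc m) = map node (childVectors N k m)

    childVectors : ℕ → (j : ℕ) → ℕ → List (Vec (Forest k) j)
    childVectors N zero    zero    = [] ∷ []
    childVectors N zero    (suc m) = []
    childVectors N (suc j) m       =
      concatAntidiagonal m (λ i l → cartesianProductWith _∷_ (forests N i) (childVectors N j l))

    forests : ℕ → ℕ → List (Forest k)
    forests N       zero    = [] ∷ []
    forests zero    (suc m) = []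
    forests (suc N) (suc m) =
      concatAntidiagonal m (λ s l → cartesianProductWith _∷_ (trees N (suc s)) (forests N l))

  mutual
    trees-sound : ∀ N n {t} → t ∈ trees N n → size t ≡ n
    trees-sound N (suc m) t∈ with ∈-map⁻ node t∈
    ... | cs , cs∈ , refl = cong suc (childVectors-sound N k m cs∈)

    childVectors-sound : ∀ N j m {v} → v ∈ childVectors N j m → sizeV v ≡ m
    childVectors-sound N zero    zero    {[]} _ = refl
    childVectors-sound N (suc j) m v∈ with ∈-concatAntidiagonal⁻ m v∈
    ... | i , l , i+l≡m , v∈G with ∈-cartesianProductWith⁻ _∷_ (forests N i) _ v∈G
    ...   | F , w , F∈ , w∈ , refl =
      trans (cong₂ ℕ._+_ (forests-sound N i F∈) (childVectors-sound N j l w∈)) i+l≡m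

    forests-sound : ∀ N n {F} → F ∈ forests N n → sizeF F ≡ n
    forests-sound N       zero    (here refl) = refl
    forests-sound (suc N) (suc m) F∈ with ∈-concatAntidiagonal⁻ m F∈
    ... | s , l , s+l≡m , F∈G with ∈-cartesianProductWith⁻ _∷_ (trees N (suc s)) _ F∈G
    ...   | t , G , t∈ , G∈ , refl =
      trans (cong₂ ℕ._+_ (trees-sound N (suc s) t∈) (forests-sound N l G∈)) (cong suc s+l≡m)

  node-injective : ∀ {cs cs′} → node {k} cs ≡ node cs′ → cs ≡ cs′
  node-injective refl = refl

  mutual
    trees-unique : ∀ N n → Unique (trees N n)
    trees-unique N zero    = []
    trees-unique N (suc m) = Unique.map⁺ node-injective (childVectors-unique N k m)

    childVectors-unique : ∀ N j m → Unique (childVectors N j m)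
    childVectors-unique N zero    zero    = All.[] ∷ []
    childVectors-unique N zero    (suc m) = []
    childVectors-unique N (suc j) m       = concatAntidiagonal-unique m firstSize
      (λ i l → Unique.cartesianProductWith⁺ _∷_ Vecₚ.∷-injective (forests-unique N i) (childVectors-unique N j l))
      keyed
      where
      firstSize : Vec (Forest k) (suc j) → ℕ
      firstSize (F ∷ _) = sizeF F
      keyed : ∀ i l {v} → v ∈ cartesianProductWith _∷_ (forests N i) (childVectors N j l) → firstSize v ≡ i
      keyed i l v∈ with ∈-cartesianProductWith⁻ _∷_ (forests N i) _ v∈
      ... | F , _ , F∈ , _ , refl = forests-sound N i F∈

    forests-unique : ∀ N n → Unique (forests N n)
    forests-unique N       zero    = All.[] ∷ []
    forests-unique zero    (suc m) = []
    forests-unique (suc N) (suc m) = concatAntidiagonal-unique m firstSize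
      (λ s l → Unique.cartesianProductWith⁺ _∷_ Listₚ.∷-injective (trees-unique N (suc s)) (forests-unique N l))
      keyed
      where
      firstSize : Forest k → ℕ
      firstSize []      = 0
      firstSize (t ∷ _) = ℕ.pred (size t)
      keyed : ∀ s l {F} → F ∈ cartesianProductWith _∷_ (trees N (suc s)) (forests N l) → firstSize F ≡ s
      keyed s l F∈ with ∈-cartesianProductWith⁻ _∷_ (trees N (suc s)) _ F∈
      ... | t , _ , t∈ , _ , refl = cong ℕ.pred (trees-sound N (suc s) t∈)

  mutual
    trees-complete : ∀ N t → size t ≤ suc N → t ∈ trees N (size t)
    trees-complete N (node cs) (s≤s size≤N) = ∈-map⁺ node (childVectors-complete N k cs size≤N)

    childVectors-complete : ∀ N j (v : Vec (Forest k) j) → sizeV v ≤ N → v ∈ childVectors N j (sizeV v)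
    childVectors-complete N zero    []      _      = here refl
    childVectors-complete N (suc j) (F ∷ v) size≤N =
      let F≤N , v≤N = summands-≤ (sizeF F) (sizeV v) refl size≤N in
      ∈-concatAntidiagonal⁺ _ (sizeF F) (sizeV v) refl
        (∈-cartesianProductWith⁺ _∷_ (forests-complete N F F≤N) (childVectors-complete N j v v≤N))

    forests-complete : ∀ N F → sizeF F ≤ N → F ∈ forests N (sizeF F)
    forests-complete N       []               _            = here refl
    forests-complete (suc N) (node cs ∷ F) (s≤s size≤N) =
      let cs≤N , F≤N = summands-≤ (sizeV cs) (sizeF F) refl size≤N in
      ∈-concatAntidiagonal⁺ _ (sizeV cs) (sizeF F) refl
        (∈-cartesianProductWith⁺ _∷_ (trees-complete N (node cs) (s≤s cs≤N)) (forests-complete N F F≤N))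

  trees-isEnumeration : ∀ N n → n ≤ suc N → IsEnumeration (λ t → size t ≡ n) (trees N n)
  trees-isEnumeration N n n≤1+N =
    trees-unique N n , (λ t → trees-sound N n) , λ { t refl → trees-complete N t n≤1+N }

  forests-isEnumeration : ∀ N n → n ≤ N → IsEnumeration (λ F → sizeF F ≡ n) (forests N n)
  forests-isEnumeration N n n≤N =
    forests-unique N n , (λ F → forests-sound N n) , λ { F refl → forests-complete N F n≤N }

module HookSums (k : ℕ) (α : ℚ) where

  c : ℚ
  c = 1ℚ + α

  open BinomialType (ℕ→ℚ k) (ℕ→ℚ (suc k) * c)
  open Enumeration k

  root-factor : ∀ m → ℕ→ℚ (suc m) * (1ℚ + α * (ℤ.+ 1 / suc m)) ≡ ℕ→ℚ m + c
  root-factor m = begin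
    ℕ→ℚ (suc m) * (1ℚ + α * (ℤ.+ 1 / suc m))      ≡⟨ distrib (ℕ→ℚ (suc m)) α (ℤ.+ 1 / suc m) ⟩
    ℕ→ℚ (suc m) + α * (ℕ→ℚ (suc m) * (ℤ.+ 1 / suc m)) ≡⟨ cong₂ (λ u v → u + α * v) (ℕ→ℚ-suc m) (ℕ→ℚ-*-inverse m) ⟩
    1ℚ + ℕ→ℚ m + α * 1ℚ                            ≡⟨ regroup (ℕ→ℚ m) α ⟩
    ℕ→ℚ m + c                                      ∎
    where
    distrib : ∀ M α I → M * (1ℚ + α * I) ≡ M + α * (M * I)
    distrib = solve-∀ ℚ-ring
    regroup : ∀ m α → 1ℚ + m + α * 1ℚ ≡ m + (1ℚ + α)
    regroup = solve-∀ ℚ-ring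

  sumℚ-hookW-trees : ∀ N m →
    sumℚ (map (hookW α) (trees N (suc m)))
      ≡ (1ℚ + α * (ℤ.+ 1 / suc m)) * sumℚ (map (hookWV α) (childVectors N k m))
  sumℚ-hookW-trees N m = trans (cong sumℚ (trans (sym (map-∘ (childVectors N k m))) (map-cong-local
    (All.tabulate (λ {cs} cs∈ → cong (λ s → (1ℚ + α * (ℤ.+ 1 / suc s)) * hookWV α cs) (childVectors-sound N k m cs∈))))))
    (sumℚ-map-*ˡ (1ℚ + α * (ℤ.+ 1 / suc m)) (hookWV α) (childVectors N k m))

  mutual
    forests-sum : ∀ N n → n ≤ N → ℕ→ℚ (n !) * sumℚ (map (hookWF α) (forests N n)) ≡ p n c
    forests-sum N       zero    _            = refl
    forests-sum (suc N) (suc m) (s≤s m≤N) = begin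
      ℕ→ℚ (suc m !) * sumℚ (map (hookWF α) (forests (suc N) (suc m)))
        ≡⟨ factorial-weighted-sum _ (hookWF α) (hookW α) (hookWF α) (λ _ _ → refl)
                                  (λ s → trees N (suc s)) (forests N) 1 m ⟩
      Σ[ s + l ≐ m ] (binomℚ (suc s) l * (ℕ→ℚ (suc s !) * sumℚ (map (hookW α) (trees N (suc s))))
                                       * (ℕ→ℚ (l !) * sumℚ (map (hookWF α) (forests N l))))
        ≡⟨ Σ-cong m (λ s l s+l≡m → let s≤N , l≤N = summands-≤ s l s+l≡m m≤N in
             cong₂ (λ u v → binomℚ (suc s) l * u * v) (trees-sum N s s≤N) (forests-sum N l l≤N)) ⟩
      Σ[ s + l ≐ m ] (binomℚ (suc s) l * (- p (suc s) (- c)) * p l c)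
        ≡⟨ forest-identity c m ⟩
      p (suc m) c ∎

    trees-sum : ∀ N m → m ≤ N → ℕ→ℚ (suc m !) * sumℚ (map (hookW α) (trees N (suc m))) ≡ - p (suc m) (- c)
    trees-sum N m m≤N = begin
      ℕ→ℚ (suc m !) * sumℚ (map (hookW α) (trees N (suc m)))
        ≡⟨ cong₂ _*_ (ℕ→ℚ-* (suc m) (m !)) (sumℚ-hookW-trees N m) ⟩
      ℕ→ℚ (suc m) * ℕ→ℚ (m !) * ((1ℚ + α * (ℤ.+ 1 / suc m)) * sumℚ (map (hookWV α) (childVectors N k m)))
        ≡⟨ interchange (ℕ→ℚ (suc m)) (ℕ→ℚ (m !)) _ _ ⟩
      ℕ→ℚ (suc m) * (1ℚ + α * (ℤ.+ 1 / suc m)) * (ℕ→ℚ (m !) * sumℚ (map (hookWV α) (childVectors N k m)))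
        ≡⟨ cong₂ _*_ (root-factor m) (childVectors-sum N k m m≤N) ⟩
      (ℕ→ℚ m + c) * p m (ℕ→ℚ k * c)
        ≡⟨ tree-identity c (cong (_* c) (ℕ→ℚ-suc k)) m ⟩
      - p (suc m) (- c) ∎
      where
      interchange : ∀ A B C D → A * B * (C * D) ≡ A * C * (B * D)
      interchange = solve-∀ ℚ-ring

    childVectors-sum : ∀ N j m → m ≤ N →
      ℕ→ℚ (m !) * sumℚ (map (hookWV α) (childVectors N j m)) ≡ p m (ℕ→ℚ j * c)
    childVectors-sum N zero    zero    _   = refl
    childVectors-sum N zero    (suc m) _   = annihilate (ℕ→ℚ (suc m !)) c (r m (0ℚ * c + ℕ→ℚ k))
      where
      annihilate : ∀ F c R → F * 0ℚ ≡ 0ℚ * c * R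
      annihilate = solve-∀ ℚ-ring
    childVectors-sum N (suc j) m m≤N = begin
      ℕ→ℚ (m !) * sumℚ (map (hookWV α) (childVectors N (suc j) m))
        ≡⟨ factorial-weighted-sum _ (hookWV α) (hookWF α) (hookWV α) (λ _ _ → refl)
                                  (forests N) (childVectors N j) 0 m ⟩
      Σ[ i + l ≐ m ] (binomℚ i l * (ℕ→ℚ (i !) * sumℚ (map (hookWF α) (forests N i)))
                                 * (ℕ→ℚ (l !) * sumℚ (map (hookWV α) (childVectors N j l))))
        ≡⟨ Σ-cong m (λ i l i+l≡m → let i≤N , l≤N = summands-≤ i l i+l≡m m≤N in
             cong₂ (λ u v → binomℚ i l * u * v) (forests-sum N i i≤N) (childVectors-sum N j l l≤N)) ⟩
      Σ[ i + l ≐ m ] (binomℚ i l * p i c * p l (ℕ→ℚ j * c))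
        ≡⟨ p-binomial m c (ℕ→ℚ j * c) ⟩
      p m (c + ℕ→ℚ j * c)
        ≡⟨ cong (p m) (trans (distrib c (ℕ→ℚ j)) (cong (_* c) (sym (ℕ→ℚ-suc j)))) ⟩
      p m (ℕ→ℚ (suc j) * c) ∎
      where
      distrib : ∀ c j → c + j * c ≡ (1ℚ + j) * c
      distrib = solve-∀ ℚ-ring

  hook-length-formula-forests : ∀ n (L : List (Forest k)) → IsEnumeration (λ F → sizeF F ≡ n) L →
    ℕ→ℚ (n !) * sumℚ (map (hookWF α) L) ≡ P n (ℕ→ℚ k) (ℕ→ℚ (suc k) * c) c
  hook-length-formula-forests n L L-enumerates = begin
    ℕ→ℚ (n !) * sumℚ (map (hookWF α) L)
      ≡⟨ cong (ℕ→ℚ (n !) *_) (sumℚ-map-enumerations (hookWF α) L-enumerates (forests-isEnumeration n n ℕₚ.≤-refl)) ⟩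
    ℕ→ℚ (n !) * sumℚ (map (hookWF α) (forests n n))
      ≡⟨ forests-sum n n ℕₚ.≤-refl ⟩
    p n c
      ≡⟨ P≡p n c ⟨
    P n (ℕ→ℚ k) (ℕ→ℚ (suc k) * c) c ∎

  hook-length-formula-trees : ∀ n → 1 ≤ n → (L : List (Tree k)) → IsEnumeration (λ T → size T ≡ n) L →
    ℕ→ℚ (n !) * sumℚ (map (hookW α) L) ≡ - P n (ℕ→ℚ k) (ℕ→ℚ (suc k) * c) (- c)
  hook-length-formula-trees (suc m) _ L L-enumerates = begin
    ℕ→ℚ (suc m !) * sumℚ (map (hookW α) L)
      ≡⟨ cong (ℕ→ℚ (suc m !) *_)
              (sumℚ-map-enumerations (hookW α) L-enumerates (trees-isEnumeration m (suc m) ℕₚ.≤-refl)) ⟩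
    ℕ→ℚ (suc m !) * sumℚ (map (hookW α) (trees m (suc m)))
      ≡⟨ trees-sum m m ℕₚ.≤-refl ⟩
    - p (suc m) (- c)
      ≡⟨ cong -_ (P≡p (suc m) (- c)) ⟨
    - P (suc m) (ℕ→ℚ k) (ℕ→ℚ (suc k) * c) (- c) ∎

corollary8p2 : (k : ℕ) → 1 ≤ k → (α : ℚ) →
    ((n : ℕ) (L : List (Forest k)) → IsEnumeration (λ F → sizeF F ≡ n) L →
      ℕ→ℚ (n !) * sumℚ (map (hookWF α) L)
        ≡ P n (ℕ→ℚ k) (ℕ→ℚ (suc k) * (1ℚ + α)) (1ℚ + α))
    ×
    ((n : ℕ) → 1 ≤ n → (L : List (Tree k)) → IsEnumeration (λ T → size T ≡ n) L →
      ℕ→ℚ (n !) * sumℚ (map (hookW α) L)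
        ≡ - P n (ℕ→ℚ k) (ℕ→ℚ (suc k) * (1ℚ + α)) (- (1ℚ + α)))
corollary8p2 k _ α = hook-length-formula-forests , hook-length-formula-trees
  where open HookSums k α
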